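{- Let $(H=(V,E),\succ)$ be a hypergraphic preference system with $V=[n]$, and run Scarf's algorithm (with any cardinal pivoting rule) on its augmented block-partitioned instance $(A',b',C')$. Let $(B,O)$ be a Scarf pair arising in the algorithm and suppose $i\in[n]$ is the separator of $(B,O)$. Then the column $i$, which corresponds to the singleton hyperedge $e_i=\{i\}$, belongs to $O$ and is $i$-disliked with respect to $O$.
   Context: In a hypergraphic preference system $(H=(V,E),\succ)$, each $\succ_i$ is a strict order on $\delta(i)=\{e\in E:i\in e\}$. Each singleton $e_i=\{i\}$ is in $E$ and is least preferred. Block-partitioned matrices. For $i\in[n]$ let $S_i=\{e\in E\setminus\{e_i\}:\max e=i\}$ (the $i$-th block). The columns are $e_1,\dots,e_n$ (columns $1..n$), then $S_1,\dots,S_n$, each in decreasing $\succ_i$-preference. $A$ is the incidence matrix. $C$ has entries $c_{i,j}=|\delta(i)|-\ell$ when $i\in e_j$ is $\ell$-th best in $\succ_i$; the other entries of row $i$ are distinct integers $\ge|\delta(i)|$ decreasing left to right. $b=\mathbf{1}$. Augmented instance: $A'=\begin{pmatrix}1&0^T\\0&A\end{pmatrix}$, $b'=(1,b^T)^T$, $C'=\begin{pmatrix}0&\xi^T\\ \chi&C\end{pmatrix}$ with $\xi=(m,\dots,1)^T$ and $\chi=(M,\dots,M)^T$, $M>\max c_{i,j}$. Rows are indexed $0..n$, columns $0..m$. Scarf's algorithm: - Utility: $u^O_i=\min_{j\in O}c'_{i,j}$. Column $j\in O$ is $i$-disliked if $u^O_i=c'_{i,j}$. - Cardinal pivot from a feasible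 basis $B$ with entering $j_t$: $y=(A'_B)^{ -1}A'_{j_t}$, and the leaving column minimizes $x_j/y_j$ over $j\in B$ with $y_j>0$, chosen by a pivoting rule. - Ordinal pivot from ordinal basis $O$ with leaving $j_\ell$: let $i_\ell$ be the row disliking $j_\ell$, $j_r=\arg\min_{j\in O\setminus\{j_\ell\}}c'_{i_\ell,j}$, and $i_r$ the row disliking $j_r$. The entering column is $j^*=\arg\max\{c'_{i_r,k}:k\notin O,\ c'_{i,k}>u^{O\setminus\{j_\ell\}}_i\ \forall i\ne i_r\}$. - Start from $B_0=\{0,\dots,n\}$, $O_0=\{1,\dots,n+1\}$. Alternate a cardinal pivot (entering $O_k\setminus B_k$) with an ordinal pivot (leaving $O_k\setminus B_{k+1}$). Stop when the bases coincide. - A Scarf pair is a pair $(B_k,O_k)$ in this sequence with $B_k\neq O_k$. Separator: for a Scarf pair $(B,O)$, let $j^{\rightarrow}$ be the $0$-disliked column with respect to $O$ (the column of $O$ with largest index). If $j^{\rightarrow}\in S_i$, then $i$ is called the separator of $(B,O)$. -}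

module Defs where

open import Data.Nat as ℕ using (ℕ; zero; suc; _∸_)
open import Data.Fin as Fin using (Fin; zero; suc; toℕ; _↑ˡ_; _↑ʳ_; splitAt)
open import Data.Fin.Subset using (Subset; ⁅_⁆; _∈_; _∉_; _∪_; _-_)
open import Data.Vec using (lookup)
import Data.Vec
import Data.Bool
open import Data.Bool using (if_then_else_)
open import Data.Sum using ([_,_]′)
open import Data.List using (List; []; _∷_; _++_; [_]; length)
open import Data.List.Relation.Unary.Unique.Propositional using (Unique)
import Data.List.Membership.Propositional as LMem
open import Data.Rational as ℚ using (ℚ; 0ℚ; 1ℚ)
open import Data.Product using (Σ; _×_; ∃; ∃₂; _,_)
open import Relation.Binary.PropositionalEquality using (_≡_; _≢_)
open import Relation.Nullary using (¬_)
open import Function.Bundles using (_⇔_)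

-- Conventions (0-based):
--  * vertex i ∈ [n] of the paper is  i : Fin n  (paper vertex = toℕ i + 1);
--  * hyperedges/columns of A are  Fin (n + k)  (so m = n + k); column
--    j ↑ˡ k (j < n) is the singleton e_j, column n ↑ʳ t is the t-th
--    non-singleton hyperedge  other t;
--  * augmented rows are Fin (suc n) (row 0 = extra row, row suc i = vertex i),
--    augmented columns are Fin (suc (n + k)) (column 0 = extra column,
--    column suc j = column j of A).

IsMax : ∀ {n} → Subset n → Fin n → Set
IsMax e i = i ∈ e × (∀ v → v ∈ e → toℕ v ℕ.≤ toℕ i)

Before : ∀ {a} {A : Set a} → List A → A → A → Set a
Before l x y = ∃₂ λ as bs → ∃ λ cs → l ≡ as ++ x ∷ bs ++ y ∷ cs

record HPS (n k : ℕ) : Set where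
  field
    other   : Fin k → Subset n
  edge : Fin (n ℕ.+ k) → Subset n
  edge j = [ ⁅_⁆ , other ]′ (splitAt n j)

  single : Fin n → Fin (n ℕ.+ k)
  single i = i ↑ˡ k

  field
    -- ≻_i as a list of the columns of δ(i), best first
    pref       : Fin n → List (Fin (n ℕ.+ k))
    -- E is a set: hyperedges are distinct
    other-inj  : ∀ t t' → other t ≡ other t' → t ≡ t'
    other-nonsingleton : ∀ t i → other t ≢ ⁅ i ⁆
    other-max  : ∀ t → ∃ λ i → IsMax (other t) i
    -- ≻_i is a strict (total) order on δ(i) = {e ∈ E : i ∈ e}
    pref-unique : ∀ i → Unique (pref i)
    pref-δ      : ∀ i j → (LMem._∈_ j (pref i)) ⇔ (i ∈ edge j)
    pref-last   : ∀ i → ∃ λ l → pref i ≡ l ++ [ single i ]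
    -- block order: blocks S_1,…,S_n in order, each in decreasing ≻_i
    block-order : ∀ t t' i i' → toℕ t ℕ.< toℕ t' →
                  IsMax (other t) i → IsMax (other t') i' →
                  toℕ i ℕ.≤ toℕ i' ×
                  (i ≡ i' → Before (pref i) (n ↑ʳ t) (n ↑ʳ t'))
    C : Fin n → Fin (n ℕ.+ k) → ℕ
    C-pref  : ∀ i j as bs → pref i ≡ as ++ j ∷ bs →
              C i j ≡ length (pref i) ∸ suc (length as)
    C-other-≥ : ∀ i j → i ∉ edge j → length (pref i) ℕ.≤ C i j
    C-other-decr : ∀ i j j' → i ∉ edge j → i ∉ edge j' →
                   toℕ j ℕ.< toℕ j' → C i j' ℕ.< C i j
    M : ℕ
    M-big : ∀ i j → C i j ℕ.< M

  m : ℕ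
  m = n ℕ.+ k

  Col : Set
  Col = Fin (suc m)

  Row : Set
  Row = Fin (suc n)

  A' : Row → Col → ℚ
  A' zero    zero    = 1ℚ
  A' zero    (suc j) = 0ℚ
  A' (suc i) zero    = 0ℚ
  A' (suc i) (suc j) = if lookup (edge j) i then 1ℚ else 0ℚ

  b' : Row → ℚ
  b' _ = 1ℚ

  -- augmented cost matrix C'  (ξ = (m,…,1), χ = (M,…,M))
  C' : Row → Col → ℕ
  C' zero    zero    = 0
  C' zero    (suc j) = m ∸ toℕ j
  C' (suc i) zero    = M
  C' (suc i) (suc j) = C i j

  colSingle : Fin n → Col
  colSingle i = suc (single i)

  InBlock : Fin n → Col → Set
  InBlock i c = ∃ λ t → c ≡ suc (n ↑ʳ t) × IsMax (other t) i

  Σℚ : ∀ {p} → (Fin p → ℚ) → ℚ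
  Σℚ {zero}  f = 0ℚ
  Σℚ {suc p} f = f zero ℚ.+ Σℚ (λ j → f (suc j))

  Disliked : Subset (suc m) → Row → Col → Set
  Disliked O r j = j ∈ O × (∀ j' → j' ∈ O → C' r j ℕ.≤ C' r j')

  IsUtility : Subset (suc m) → Row → ℕ → Set
  IsUtility O r u = (∃ λ j → j ∈ O × C' r j ≡ u) × (∀ j → j ∈ O → u ℕ.≤ C' r j)

  SolvesOn : Subset (suc m) → (Row → ℚ) → (Col → ℚ) → Set
  SolvesOn B v z = (∀ j → j ∉ B → z j ≡ 0ℚ) ×
                   (∀ r → Σℚ (λ j → A' r j ℚ.* z j) ≡ v r)

  FeasibleSol : Subset (suc m) → (Col → ℚ) → Set
  FeasibleSol B x = SolvesOn B b' x × (∀ j → 0ℚ ℚ.≤ x j)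

  -- cardinal pivot: B' is obtained from the feasible basis B by letting
  -- jt enter and a ratio-test minimiser jl leave
  -- (x_jl / y_jl ≤ x_j / y_j written as x_jl * y_j ≤ x_j * y_jl, y's > 0)
  CardPivot : Subset (suc m) → Col → Subset (suc m) → Set
  CardPivot B jt B' =
    Σ (Col → ℚ) λ x → Σ (Col → ℚ) λ y → Σ Col λ jl →
      FeasibleSol B x × SolvesOn B (λ r → A' r jt) y ×
      jl ∈ B × 0ℚ ℚ.< y jl ×
      (∀ j → j ∈ B → 0ℚ ℚ.< y j → x jl ℚ.* y j ℚ.≤ x j ℚ.* y jl) ×
      B' ≡ (B - jl) ∪ ⁅ jt ⁆

  OrdPivot : Subset (suc m) → Col → Subset (suc m) → Set
  OrdPivot O jl O' =
    Σ Row λ il → Σ Col λ jr → Σ Row λ ir → Σ Col λ j* →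
      Disliked O il jl ×
      Disliked (O - jl) il jr ×
      Disliked O ir jr ×
      j* ∉ O ×
      (∀ i → i ≢ ir → ∀ u → IsUtility (O - jl) i u → u ℕ.< C' i j*) ×
      (∀ k' → k' ∉ O →
        (∀ i → i ≢ ir → ∀ u → IsUtility (O - jl) i u → u ℕ.< C' i k') →
        C' ir k' ℕ.≤ C' ir j*) ×
      O' ≡ (O - jl) ∪ ⁅ j* ⁆

  B₀ : Subset (suc m)
  B₀ = Data.Vec.tabulate (λ j → toℕ j ℕ.≤ᵇ n)

  O₀ : Subset (suc m)
  O₀ = Data.Vec.tabulate (λ j → (1 ℕ.≤ᵇ toℕ j) Data.Bool.∧ (toℕ j ℕ.≤ᵇ suc n))

  data Reachable : Subset (suc m) → Subset (suc m) → Set where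
    start : Reachable B₀ O₀
    step  : ∀ {B O B' O'} jt jl →
            Reachable B O → B ≢ O →
            jt ∈ O → jt ∉ B → CardPivot B jt B' →
            B' ≢ O →
            jl ∈ O → jl ∉ B' → OrdPivot O jl O' →
            Reachable B' O'

  ScarfPair : Subset (suc m) → Subset (suc m) → Set
  ScarfPair B O = Reachable B O × B ≢ O

  Separator : Subset (suc m) → Subset (suc m) → Fin n → Set
  Separator B O i = ∃ λ j → Disliked O zero j × InBlock i j

-- Two invariants of the ordinal bases O met along the run: every column outside O
-- undercuts the utility of some row on O, and no column of O is disliked by two rows.
-- Both hold for O₀ and survive every ordinal pivot (row-wise injectivity of C' does
-- the work); the cardinal side never matters.  Now let J ∈ S_i be the 0-disliked
-- column of O, i.e. the one of largest index.  If e_i ∉ O, every other column of O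
-- has smaller index and so is column 0, a hyperedge not containing i, or an earlier
-- member of S_i, which i prefers to J by the block order; hence J would be
-- i-disliked as well, against the second invariant.  So e_i ∈ O, and as the least
-- preferred edge of i (cost 0) it is i-disliked.

module Submission where

open import Defs
open import Data.Nat using (ℕ)
import Data.Nat
open import Data.Fin using (Fin)
import Data.Fin
open import Data.Fin.Subset using (Subset; _∈_)
open import Data.Product using (_×_)

open import Data.Nat using (zero; suc; _∸_; _≤_; _<_; z≤n; s≤s; _≤?_)
open import Data.Nat.Properties
  using (≤-refl; ≤-trans; <⇒≤; <-≤-trans; ≤-<-trans; ≤-antisym; <-irrefl; ≰⇒>;
         suc-injective; m<m+n; <⇒≱; ≤-reflexive; +-cancelˡ-≤; ≤∧≢⇒<; ∸-monoʳ-≤; ∸-monoʳ-<;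
         ∸-cancelˡ-≡; m<n⇒0<n∸m; ≤ᵇ⇒≤; ≤⇒≤ᵇ; <-cmp)
open import Data.Fin using (zero; suc; toℕ; fromℕ<; _↑ˡ_; _↑ʳ_; splitAt)
open import Data.Fin.Properties
  using (toℕ<n; toℕ-injective; toℕ-↑ˡ; toℕ-↑ʳ; toℕ-fromℕ<; ↑ˡ-injective; 0≢1+n;
         splitAt-↑ˡ; splitAt-↑ʳ; join-splitAt; any?; all?; ¬∀⟶∃¬)
  renaming (_≟_ to _≟ᶠ_)
open import Data.Fin.Subset using (_∉_; _─_; _-_; _∪_; ⁅_⁆; outside)
open import Data.Fin.Subset.Properties
  using (_∈?_; x∈⁅x⁆; x∈⁅y⁆⇒x≡y; x∈p∪q⁻; x∈p∪q⁺; p─q⊆p; x∈p∧x≢y⇒x∈p-y)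
open import Data.Vec using (_∷_; tabulate; here; there)
open import Data.Vec.Properties using (lookup∘tabulate; []=⇒lookup; lookup⇒[]=)
open import Data.Bool using (Bool; T)
open import Data.Bool.Properties using (T-≡)
open import Data.Sum using (_⊎_; inj₁; inj₂)
open import Data.Product using (∃; _,_; proj₁; proj₂; uncurry)
open import Data.Empty using (⊥-elim)
open import Data.List using (List; []; _∷_; _++_; [_]; length; filter; allFin)
open import Data.List.Properties using (∷-injectiveˡ; ∷-injectiveʳ; length-++; ++-assoc)
open import Data.List.Membership.Propositional.Properties
  using (∈-∃++; ∈-filter⁺; ∈-filter⁻; ∈-allFin)
import Data.List.Relation.Unary.All as All
open import Data.List.Extrema.Nat using (argmin; argmin-sel; f[argmin]≤f[xs])
open import Relation.Binary.PropositionalEquality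
  using (_≡_; _≢_; refl; sym; trans; cong; subst; subst₂)
open import Relation.Nullary using (¬_; Dec; yes; no)
open import Relation.Binary using (tri<; tri≈; tri>)
open import Relation.Nullary.Decidable using (_×-dec_; _→-dec_; ¬?)
open import Function using (_∘_)
open import Function.Bundles using (Equivalence)

same-position⇒same-element : ∀ {a} {A : Set a} (as as' : List A) {x y : A} {bs bs'} →
  as ++ x ∷ bs ≡ as' ++ y ∷ bs' → length as ≡ length as' → x ≡ y
same-position⇒same-element []       []         eq _   = ∷-injectiveˡ eq
same-position⇒same-element (_ ∷ as) (_ ∷ as') eq len =
  same-position⇒same-element as as' (∷-injectiveʳ eq) (suc-injective len)

length-prefix< : ∀ {a} {A : Set a} (as : List A) (x : A) bs →
  length as < length (as ++ x ∷ bs)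
length-prefix< as x bs = subst (length as <_) (sym (length-++ as)) (m<m+n (length as) (s≤s z≤n))

x∈p─q⇒x∉q : ∀ {N} (p q : Subset N) {x} → x ∈ p ─ q → x ∉ q
x∈p─q⇒x∉q (_ ∷ p) (outside ∷ q) here      ()
x∈p─q⇒x∉q (_ ∷ p) (_       ∷ q) (there x∈) (there x∈q) = x∈p─q⇒x∉q p q x∈ x∈q

x∈p-y⇒x∈p : ∀ {N} {p : Subset N} {x y} → x ∈ p - y → x ∈ p
x∈p-y⇒x∈p {p = p} {y = y} = p─q⊆p p ⁅ y ⁆

x∈p-y⇒x≢y : ∀ {N} {p : Subset N} {x y} → x ∈ p - y → x ≢ y
x∈p-y⇒x≢y {p = p} {x} x∈ refl = x∈p─q⇒x∉q p ⁅ x ⁆ x∈ (x∈⁅x⁆ x)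

∈-tabulate⁺ : ∀ {N} (f : Fin N → Bool) {j} → T (f j) → j ∈ tabulate f
∈-tabulate⁺ f {j} t =
  lookup⇒[]= j (tabulate f) (trans (lookup∘tabulate f j) (Equivalence.to T-≡ t))

∈-tabulate⁻ : ∀ {N} (f : Fin N → Bool) {j} → j ∈ tabulate f → T (f j)
∈-tabulate⁻ f {j} j∈ =
  Equivalence.from T-≡ (trans (sym (lookup∘tabulate f j)) ([]=⇒lookup j∈))

∃-minimiser : ∀ {N} (f : Fin N → ℕ) {S : Subset N} {j₀} → j₀ ∈ S →
  ∃ λ j → j ∈ S × (∀ j' → j' ∈ S → f j ≤ f j')
∃-minimiser f {S} {j₀} j₀∈S = argmin f j₀ xs , argmin∈S , minimal
  where
  xs : List (Fin _)
  xs = filter (_∈? S) (allFin _)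
  argmin∈S : argmin f j₀ xs ∈ S
  argmin∈S with argmin-sel f j₀ xs
  ... | inj₁ eq   = subst (_∈ S) (sym eq) j₀∈S
  ... | inj₂ ∈xs = proj₂ (∈-filter⁻ (_∈? S) {xs = allFin _} ∈xs)
  minimal : ∀ j' → j' ∈ S → f (argmin f j₀ xs) ≤ f j'
  minimal j' j'∈S =
    All.lookup (f[argmin]≤f[xs] j₀ xs) (∈-filter⁺ (_∈? S) {xs = allFin _} (∈-allFin j') j'∈S)

module _ {n k : ℕ} (P : HPS n k) where
  open HPS P

  edge-↑ˡ : ∀ w → edge (w ↑ˡ k) ≡ ⁅ w ⁆
  edge-↑ˡ w rewrite splitAt-↑ˡ n w k = refl

  edge-↑ʳ : ∀ t → edge (n ↑ʳ t) ≡ other t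
  edge-↑ʳ t rewrite splitAt-↑ʳ n k t = refl

  ↑ˡ-or-↑ʳ : (c : Fin m) → (∃ λ w → c ≡ w ↑ˡ k) ⊎ (∃ λ t → c ≡ n ↑ʳ t)
  ↑ˡ-or-↑ʳ c with splitAt n c | join-splitAt n k c
  ... | inj₁ w | eq = inj₁ (w , sym eq)
  ... | inj₂ t | eq = inj₂ (t , sym eq)

  pref-position< : ∀ i j as bs → pref i ≡ as ++ j ∷ bs → suc (length as) ≤ length (pref i)
  pref-position< i j as bs eq = subst (length as <_) (sym (cong length eq)) (length-prefix< as j bs)

  C-member< : ∀ {i j} → i ∈ edge j → C i j < length (pref i)
  C-member< {i} {j} i∈j with ∈-∃++ (Equivalence.from (pref-δ i j) i∈j)
  ... | as , bs , eq rewrite C-pref i j as bs eq =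
    ∸-monoʳ-< (s≤s z≤n) (pref-position< i j as bs eq)

  C-member<nonmember : ∀ {i a b} → i ∈ edge a → i ∉ edge b → C i a < C i b
  C-member<nonmember {i} {a} {b} i∈a i∉b = <-≤-trans (C-member< i∈a) (C-other-≥ i b i∉b)

  C-injective : ∀ i {a b} → C i a ≡ C i b → a ≡ b
  C-injective i {a} {b} eq with i ∈? edge a | i ∈? edge b
  ... | yes i∈a | yes i∈b
    with ∈-∃++ (Equivalence.from (pref-δ i a) i∈a) | ∈-∃++ (Equivalence.from (pref-δ i b) i∈b)
  ...   | as , bs , eqa | as' , bs' , eqb =
    same-position⇒same-element as as' (trans (sym eqa) eqb)
      (suc-injective (∸-cancelˡ-≡ (pref-position< i a as bs eqa) (pref-position< i b as' bs' eqb)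
        (trans (sym (C-pref i a as bs eqa)) (trans eq (C-pref i b as' bs' eqb)))))
  C-injective i eq | yes i∈a | no i∉b = ⊥-elim (<-irrefl eq (C-member<nonmember i∈a i∉b))
  C-injective i eq | no i∉a | yes i∈b = ⊥-elim (<-irrefl (sym eq) (C-member<nonmember i∈b i∉a))
  C-injective i {a} {b} eq | no i∉a | no i∉b with <-cmp (toℕ a) (toℕ b)
  ... | tri< a<b _ _ = ⊥-elim (<-irrefl (sym eq) (C-other-decr i a b i∉a i∉b a<b))
  ... | tri≈ _ a≡b _ = toℕ-injective a≡b
  ... | tri> _ _ b<a = ⊥-elim (<-irrefl eq (C-other-decr i b a i∉b i∉a b<a))

  C'-injective : ∀ r {a b} → C' r a ≡ C' r b → a ≡ b
  C'-injective zero    {zero}  {zero}  _  = refl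
  C'-injective zero    {zero}  {suc b} eq = ⊥-elim (<-irrefl eq (m<n⇒0<n∸m (toℕ<n b)))
  C'-injective zero    {suc a} {zero}  eq = ⊥-elim (<-irrefl (sym eq) (m<n⇒0<n∸m (toℕ<n a)))
  C'-injective zero    {suc a} {suc b} eq =
    cong suc (toℕ-injective (∸-cancelˡ-≡ (<⇒≤ (toℕ<n a)) (<⇒≤ (toℕ<n b)) eq))
  C'-injective (suc i) {zero}  {zero}  _  = refl
  C'-injective (suc i) {zero}  {suc b} eq = ⊥-elim (<-irrefl (sym eq) (M-big i b))
  C'-injective (suc i) {suc a} {zero}  eq = ⊥-elim (<-irrefl eq (M-big i a))
  C'-injective (suc i) {suc a} {suc b} eq = cong suc (C-injective i eq)

  C-single : ∀ i → C i (single i) ≡ 0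
  C-single i with pref-last i
  ... | l , eq = trans (C-pref i (single i) l [] eq)
    (subst (λ L → length L ∸ suc (length l) ≡ 0) (sym eq) (lastPosition l))
    where
    lastPosition : ∀ l → length (l ++ [ single i ]) ∸ suc (length l) ≡ 0
    lastPosition []      = refl
    lastPosition (_ ∷ l) = lastPosition l

  C-antitone-along-pref : ∀ {i a b} → Before (pref i) a b → C i b ≤ C i a
  C-antitone-along-pref {i} {a} {b} (as , bs , cs , eq)
    rewrite C-pref i a as (bs ++ b ∷ cs) eq
          | C-pref i b (as ++ a ∷ bs) cs (trans eq (sym (++-assoc as (a ∷ bs) (b ∷ cs)))) =
    ∸-monoʳ-≤ (length (pref i)) (s≤s (<⇒≤ (length-prefix< as a bs)))

  Undercuts : Subset (suc m) → Row → Col → Set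
  Undercuts S r c = ∀ j → j ∈ S → C' r c ≤ C' r j

  undercuts? : ∀ S r c → Dec (Undercuts S r c)
  undercuts? S r c = all? λ j → (j ∈? S) →-dec (C' r c ≤? C' r j)

  IsOrdinalBasis : Subset (suc m) → Set
  IsOrdinalBasis O = ∀ c → c ∉ O → ∃ λ r → Undercuts O r c

  UniquelyDisliked : Subset (suc m) → Set
  UniquelyDisliked O = ∀ {r r' j} → Disliked O r j → Disliked O r' j → r ≡ r'

  ∃-disliked : ∀ {S j₀} r → j₀ ∈ S → ∃ λ j → Disliked S r j
  ∃-disliked r j₀∈S = ∃-minimiser (C' r) j₀∈S

  disliked-unique : ∀ {S} r {a b} → Disliked S r a → Disliked S r b → a ≡ b
  disliked-unique r (a∈ , a-min) (b∈ , b-min) =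
    C'-injective r (≤-antisym (a-min _ b∈) (b-min _ a∈))

  utility<-unless-undercut : ∀ {S} r {c u} → ¬ Undercuts S r c → IsUtility S r u → u < C' r c
  utility<-unless-undercut {S} r {c} ¬under (_ , u-min)
    with ¬∀⟶∃¬ (suc m) _ (λ j → (j ∈? S) →-dec (C' r c ≤? C' r j)) ¬under
  ... | j , ¬c≤j with j ∈? S
  ...   | yes j∈S = ≤-<-trans (u-min j j∈S) (≰⇒> λ c≤j → ¬c≤j λ _ → c≤j)
  ...   | no  j∉S = ⊥-elim (¬c≤j λ j∈S → ⊥-elim (j∉S j∈S))

  module OrdinalPivot
    {O O' : Subset (suc m)} {jl jr js : Col} {il ir : Row}
    (basis : IsOrdinalBasis O)
    (il-jl : Disliked O il jl) (il-jr : Disliked (O - jl) il jr) (ir-jr : Disliked O ir jr)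
    (js∉O : js ∉ O)
    (js-admissible : ∀ i → i ≢ ir → ∀ u → IsUtility (O - jl) i u → u < C' i js)
    (js-maximal : ∀ k' → k' ∉ O →
                  (∀ i → i ≢ ir → ∀ u → IsUtility (O - jl) i u → u < C' i k') →
                  C' ir k' ≤ C' ir js)
    (O'≡ : O' ≡ (O - jl) ∪ ⁅ js ⁆)
    where

    ∈O'⁻ : ∀ {j} → j ∈ O' → j ∈ O - jl ⊎ j ≡ js
    ∈O'⁻ {j} j∈O' with x∈p∪q⁻ (O - jl) ⁅ js ⁆ (subst (j ∈_) O'≡ j∈O')
    ... | inj₁ j∈ = inj₁ j∈
    ... | inj₂ j∈ = inj₂ (x∈⁅y⁆⇒x≡y js j∈)

    ∈O'⁺ : ∀ {j} → j ∈ O - jl → j ∈ O'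
    ∈O'⁺ j∈ = subst (_ ∈_) (sym O'≡) (x∈p∪q⁺ (inj₁ j∈))

    js∈O' : js ∈ O'
    js∈O' = subst (js ∈_) (sym O'≡) (x∈p∪q⁺ (inj₂ (x∈⁅x⁆ js)))

    jr∈O-jl : jr ∈ O - jl
    jr∈O-jl = proj₁ il-jr

    il≢ir : il ≢ ir
    il≢ir refl = x∈p-y⇒x≢y jr∈O-jl (sym (disliked-unique il il-jl ir-jr))

    restrict : ∀ r c → Undercuts O r c → Undercuts (O - jl) r c
    restrict _ _ under j j∈ = under j (x∈p-y⇒x∈p j∈)

    cheaper-than-js : ∀ {r} → r ≢ ir → ∃ λ d → d ∈ O - jl × C' r d < C' r js
    cheaper-than-js {r} r≢ir with ∃-disliked r jr∈O-jl
    ... | d , d∈ , d-min = d , d∈ , js-admissible r r≢ir (C' r d) ((d , d∈ , refl) , d-min)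

    undercut-keeps : ∀ r c → Undercuts (O - jl) r c → C' r c ≤ C' r js → Undercuts O' r c
    undercut-keeps _ _ under c≤js j j∈O' with ∈O'⁻ j∈O'
    ... | inj₁ j∈   = under j j∈
    ... | inj₂ refl = c≤js

    undercut-extends : ∀ {r} c → r ≢ ir → Undercuts (O - jl) r c → Undercuts O' r c
    undercut-extends {r} c r≢ir under with cheaper-than-js r≢ir
    ... | d , d∈ , d<js = undercut-keeps r c under (<⇒≤ (≤-<-trans (under _ d∈) d<js))

    -- js ∉ O is undercut by some row of O, and no row other than ir can do it.
    ir-undercuts-js : Undercuts O ir js
    ir-undercuts-js with basis js js∉O
    ... | r , under with r ≟ᶠ ir
    ...   | yes refl = under
    ...   | no r≢ir with cheaper-than-js r≢ir
    ...     | d , d∈ , d<js = ⊥-elim (<⇒≱ d<js (under d (x∈p-y⇒x∈p d∈)))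

    undercut-by-ir : ∀ {c} → c ∉ O → (∀ r → r ≢ ir → ¬ Undercuts (O - jl) r c) → Undercuts O' ir c
    undercut-by-ir {c} c∉O none =
      undercut-keeps ir c (λ j j∈ → ≤-trans c≤js (ir-undercuts-js j (x∈p-y⇒x∈p j∈))) c≤js
      where
      c≤js : C' ir c ≤ C' ir js
      c≤js = js-maximal c c∉O λ r r≢ir _ util → utility<-unless-undercut r (none r r≢ir) util

    isOrdinalBasis' : IsOrdinalBasis O'
    isOrdinalBasis' c c∉O' with c ≟ᶠ jl
    ... | yes refl = il , undercut-extends jl il≢ir (restrict il jl (proj₂ il-jl))
    ... | no c≢jl with any? (λ r → ¬? (r ≟ᶠ ir) ×-dec undercuts? (O - jl) r c)
    ...   | yes (r , r≢ir , under) = r , undercut-extends c r≢ir under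
    ...   | no none = ir , undercut-by-ir c∉O (λ r r≢ir under → none (r , r≢ir , under))
      where
      c∉O : c ∉ O
      c∉O c∈O = c∉O' (∈O'⁺ (x∈p∧x≢y⇒x∈p-y c∈O c≢jl))

    ir-dislikes-js : Disliked O' ir js
    ir-dislikes-js = js∈O' , undercut-keeps ir js (restrict ir js ir-undercuts-js) ≤-refl

    il-dislikes-jr : Disliked O' il jr
    il-dislikes-jr = ∈O'⁺ jr∈O-jl , undercut-extends jr il≢ir (proj₂ il-jr)

    disliked-kept : ∀ {r j} → r ≢ ir → Disliked O' r j → j ∈ O - jl
    disliked-kept r≢ir (j∈O' , j-min) with ∈O'⁻ j∈O'
    ... | inj₁ j∈ = j∈
    ... | inj₂ refl with cheaper-than-js r≢ir
    ...   | d , d∈ , d<js = ⊥-elim (<⇒≱ d<js (j-min d (∈O'⁺ d∈)))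

    module _ (unique : UniquelyDisliked O) where

      disliked-before : ∀ {r j} → r ≢ ir → r ≢ il → Disliked O' r j → Disliked O r j
      disliked-before {r} {j} r≢ir r≢il d@(_ , j-min) =
        x∈p-y⇒x∈p (disliked-kept r≢ir d) , j-min-O
        where
        -- r's favourite in O cannot be jl, which only il dislikes.
        j-min-O : Undercuts O r j
        j-min-O j' j'∈O with j' ≟ᶠ jl
        ... | no j'≢jl = j-min j' (∈O'⁺ (x∈p∧x≢y⇒x∈p-y j'∈O j'≢jl))
        ... | yes refl with ∃-disliked r j'∈O
        ...   | f , f-dis@(f∈O , f-min) with f ≟ᶠ jl
        ...     | yes refl = ⊥-elim (r≢il (unique f-dis il-jl))
        ...     | no f≢jl =
          ≤-trans (j-min f (∈O'⁺ (x∈p∧x≢y⇒x∈p-y f∈O f≢jl))) (f-min jl (proj₁ il-jl))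

      only-ir : ∀ {r j} → Disliked O' ir j → Disliked O' r j → r ≡ ir
      only-ir {r} d d' with r ≟ᶠ ir
      ... | yes r≡ir = r≡ir
      ... | no r≢ir = ⊥-elim (js∉O (x∈p-y⇒x∈p
        (subst (_∈ O - jl) (disliked-unique ir d ir-dislikes-js) (disliked-kept r≢ir d'))))

      only-il : ∀ {r j} → r ≢ ir → Disliked O' il j → Disliked O' r j → r ≡ il
      only-il {r} r≢ir d d' with r ≟ᶠ il
      ... | yes r≡il = r≡il
      ... | no r≢il = ⊥-elim (r≢ir (unique
        (subst (Disliked O r) (disliked-unique il d il-dislikes-jr) (disliked-before r≢ir r≢il d'))
        ir-jr))

      uniquelyDisliked' : UniquelyDisliked O'
      uniquelyDisliked' {r} {r'} d d' with r ≟ᶠ ir | r' ≟ᶠ ir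
      ... | yes refl | _        = sym (only-ir d d')
      ... | no r≢ir  | yes refl = only-ir d' d
      ... | no r≢ir  | no r'≢ir with r ≟ᶠ il | r' ≟ᶠ il
      ...   | yes refl | _        = sym (only-il r'≢ir d d')
      ...   | no r≢il  | yes refl = only-il r≢ir d' d
      ...   | no r≢il  | no r'≢il =
        unique (disliked-before r≢ir r≢il d) (disliked-before r'≢ir r'≢il d')

  ordPivot-preserves : ∀ {O jl O'} → OrdPivot O jl O' →
    IsOrdinalBasis O → UniquelyDisliked O → IsOrdinalBasis O' × UniquelyDisliked O'
  ordPivot-preserves (il , _ , ir , _ , il-jl , il-jr , ir-jr , js∉O , admissible , maximal , O'≡)
                     basis unique =
    isOrdinalBasis' , uniquelyDisliked' unique
    where open OrdinalPivot {il = il} {ir = ir} basis il-jl il-jr ir-jr js∉O admissible maximal O'≡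

  0-disliked-has-max-index : ∀ {S j j'} → Disliked S zero (suc j) → suc j' ∈ S → toℕ j' ≤ toℕ j
  0-disliked-has-max-index {j = j} {j'} (_ , j-min) j'∈S with toℕ j' ≤? toℕ j
  ... | yes j'≤j = j'≤j
  ... | no  j'≰j = ⊥-elim (<⇒≱ (∸-monoʳ-< (≰⇒> j'≰j) (<⇒≤ (toℕ<n j'))) (j-min _ j'∈S))

  single-disliked : ∀ {S} i → colSingle i ∈ S → Disliked S (suc i) (colSingle i)
  single-disliked i single∈S = single∈S , λ j _ → subst (_≤ C' (suc i) j) (sym (C-single i)) z≤n

  O₀-member : Col → Bool
  O₀-member j = (1 Data.Nat.≤ᵇ toℕ j) Data.Bool.∧ (toℕ j Data.Nat.≤ᵇ suc n)

  suc∈O₀ : ∀ {d} → toℕ d ≤ n → suc d ∈ O₀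
  suc∈O₀ d≤n = ∈-tabulate⁺ O₀-member (≤⇒≤ᵇ (s≤s d≤n))

  suc∈O₀⁻ : ∀ {d} → suc d ∈ O₀ → toℕ d ≤ n
  suc∈O₀⁻ {d} d∈O₀ = Data.Nat.s≤s⁻¹ (≤ᵇ⇒≤ (suc (toℕ d)) (suc n) (∈-tabulate⁻ O₀-member d∈O₀))

  zero∉O₀ : zero ∉ O₀
  zero∉O₀ = ∈-tabulate⁻ O₀-member

  single∈O₀ : ∀ i → colSingle i ∈ O₀
  single∈O₀ i = suc∈O₀ (subst (_≤ n) (sym (toℕ-↑ˡ i k)) (<⇒≤ (toℕ<n i)))

  isOrdinalBasis-O₀ : IsOrdinalBasis O₀
  isOrdinalBasis-O₀ c c∉O₀ = zero , undercut c c∉O₀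
    where
    undercut : ∀ c → c ∉ O₀ → Undercuts O₀ zero c
    undercut zero    _     _       _    = z≤n
    undercut (suc c) _     zero    0∈O₀ = ⊥-elim (zero∉O₀ 0∈O₀)
    undercut (suc c) c∉O₀ (suc d) d∈O₀ with toℕ c ≤? n
    ... | yes c≤n = ⊥-elim (c∉O₀ (suc∈O₀ c≤n))
    ... | no  c≰n = ∸-monoʳ-≤ m (≤-trans (suc∈O₀⁻ d∈O₀) (<⇒≤ (≰⇒> c≰n)))

  vertex-dislikes-single-in-O₀ : ∀ i {j} → Disliked O₀ (suc i) j → j ≡ colSingle i
  vertex-dislikes-single-in-O₀ i d = disliked-unique (suc i) d (single-disliked i (single∈O₀ i))

  -- O₀ also contains column n + 1, whose row-0 cost is below that of every singleton.
  single-not-0-disliked-in-O₀ : n < m → ∀ i → ¬ Disliked O₀ zero (colSingle i)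
  single-not-0-disliked-in-O₀ n<m i d =
    <⇒≱ (subst (_< n) (sym (toℕ-↑ˡ i k)) (toℕ<n i))
        (subst (_≤ toℕ (single i)) (toℕ-fromℕ< n<m) (0-disliked-has-max-index d first-nonsingleton∈O₀))
    where
    first-nonsingleton∈O₀ : suc (fromℕ< n<m) ∈ O₀
    first-nonsingleton∈O₀ = suc∈O₀ (≤-reflexive (toℕ-fromℕ< n<m))

  uniquelyDisliked-O₀ : n < m → UniquelyDisliked O₀
  uniquelyDisliked-O₀ n<m {zero}  {zero}   _ _  = refl
  uniquelyDisliked-O₀ n<m {zero}  {suc i'} d d' = ⊥-elim (single-not-0-disliked-in-O₀ n<m i'
    (subst (Disliked O₀ zero) (vertex-dislikes-single-in-O₀ i' d') d))
  uniquelyDisliked-O₀ n<m {suc i} {zero}   d d' = ⊥-elim (single-not-0-disliked-in-O₀ n<m i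
    (subst (Disliked O₀ zero) (vertex-dislikes-single-in-O₀ i d) d'))
  uniquelyDisliked-O₀ n<m {suc i} {suc i'} d d' = cong suc (↑ˡ-injective k i i'
    (Data.Fin.Properties.suc-injective
      (trans (sym (vertex-dislikes-single-in-O₀ i d)) (vertex-dislikes-single-in-O₀ i' d'))))

  reachable-invariant : n < m → ∀ {B O} → Reachable B O →
    IsOrdinalBasis O × UniquelyDisliked O
  reachable-invariant n<m start = isOrdinalBasis-O₀ , uniquelyDisliked-O₀ n<m
  reachable-invariant n<m (step _ _ reachable _ _ _ _ _ _ _ pivot) =
    uncurry (ordPivot-preserves pivot) (reachable-invariant n<m reachable)

  earlier-in-same-block : ∀ {i t t'} → IsMax (other t) i → i ∈ other t' → toℕ t' < toℕ t →
    Before (pref i) (n ↑ʳ t') (n ↑ʳ t)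
  earlier-in-same-block {i} {t} {t'} i-max i∈t' t'<t with other-max t'
  ... | i' , i'-max with block-order t' t i' i t'<t i'-max i-max
  ...   | i'≤i , before with toℕ-injective (≤-antisym i'≤i (proj₂ i'-max i i∈t'))
  ...     | refl = before refl

  block-column-cheapest : ∀ {i t} → IsMax (other t) i →
    ∀ c → c ≢ single i → toℕ c ≤ toℕ (n ↑ʳ t) → C i (n ↑ʳ t) ≤ C i c
  block-column-cheapest {i} {t} i-max c c≢i c≤t = cheapest (↑ˡ-or-↑ʳ c)
    where
    i∈t : i ∈ edge (n ↑ʳ t)
    i∈t = subst (i ∈_) (sym (edge-↑ʳ t)) (proj₁ i-max)

    cheapest : (∃ λ w → c ≡ w ↑ˡ k) ⊎ (∃ λ t' → c ≡ n ↑ʳ t') → C i (n ↑ʳ t) ≤ C i c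
    cheapest (inj₁ (w , refl)) = <⇒≤ (C-member<nonmember i∈t λ i∈w →
      c≢i (cong (_↑ˡ k) (sym (x∈⁅y⁆⇒x≡y w (subst (i ∈_) (edge-↑ˡ w) i∈w)))))
    cheapest (inj₂ (t' , refl)) with i ∈? edge (n ↑ʳ t') | t' ≟ᶠ t
    ... | no i∉t' | _        = <⇒≤ (C-member<nonmember i∈t i∉t')
    ... | yes _   | yes refl = ≤-refl
    ... | yes i∈t' | no t'≢t = C-antitone-along-pref
      (earlier-in-same-block i-max (subst (i ∈_) (edge-↑ʳ t') i∈t')
        (≤∧≢⇒< t'≤t (t'≢t ∘ toℕ-injective)))
      where
      t'≤t : toℕ t' ≤ toℕ t
      t'≤t = +-cancelˡ-≤ n _ _ (subst₂ _≤_ (toℕ-↑ʳ n t') (toℕ-↑ʳ n t) c≤t)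

  block-column-disliked : ∀ {O i J} → colSingle i ∉ O → Disliked O zero J → InBlock i J →
    Disliked O (suc i) J
  block-column-disliked {O} {i} single∉O J-dis@(J∈O , _) (t , refl , i-max) = J∈O , cheapest
    where
    cheapest : Undercuts O (suc i) (suc (n ↑ʳ t))
    cheapest zero    _    = <⇒≤ (M-big i (n ↑ʳ t))
    cheapest (suc c) c∈O = block-column-cheapest i-max c
      (λ { refl → single∉O c∈O }) (0-disliked-has-max-index J-dis c∈O)

  separator-single∈ : ∀ {O i J} → UniquelyDisliked O → Disliked O zero J → InBlock i J →
    colSingle i ∈ O
  separator-single∈ {O} {i} unique J-dis J-block with colSingle i ∈? O
  ... | yes single∈O = single∈O
  ... | no  single∉O = ⊥-elim (0≢1+n (unique J-dis (block-column-disliked single∉O J-dis J-block)))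

lemma3p4 : ∀ {n k} (P : HPS n k) → let open HPS P in
    ∀ (B O : Subset (Data.Nat.suc m)) (i : Fin n) →
    ScarfPair B O → Separator B O i →
    colSingle i ∈ O × Disliked O (Data.Fin.suc i) (colSingle i)
lemma3p4 {n} P B O i (reachable , _) (J , J-dis , J-block@(t , _)) =
  single∈O , single-disliked P i single∈O
  where
  n<m : n < HPS.m P
  n<m = m<m+n n (≤-<-trans z≤n (toℕ<n t))

  single∈O : HPS.colSingle P i ∈ O
  single∈O = separator-single∈ P (proj₂ (reachable-invariant P n<m reachable)) J-dis J-block
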